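{- Let $q$ be a prime power, $r\geq 1$, and let $\tau$ be a permutation of $F_q^r$ with $\tau({\bf 0})={\bf 0}$. For each $a\in F_q^r$ choose $x_a\in C_a$ and let $y_a=e_{\bf 0}-e_a$. Let $z_1,\dots,z_{\dim C}$ be a basis of $C$, and let $v_1,\dots,v_l$ be vectors completing a basis of $D\cap\tau(D)$ to a basis of $D$. Define $$B=\{(x_a|y_{\tau(a)}):a\in F_q^r\setminus\{{\bf 0}\}\},\quad B'=\{(z_i|{\bf 0}):1\le i\le \dim C\},\quad B''=\{({\bf 0}|v_j):1\le j\le l\},$$ and $S_\tau=\bigcup_{a\in F_q^r}C_a\times D_{\tau(a)}$. Then every vector of $B\cup B'\cup B''$ lies in $S_\tau$, and $S_\tau\subseteq\langle B\cup B'\cup B''\rangle$, the $F_q$-linear span of $B\cup B'\cup B''$.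
   Context: Let $n=\frac{q^r-1}{q-1}$. Let $H_C$ be an $r\times n$ matrix over $F_q$ whose columns are representatives of the $n$ distinct one-dimensional subspaces of $F_q^r$, $C=\{x\in F_q^n: H_Cx^T={\bf 0}\}$ (the $q$-ary Hamming code), and for $a\in F_q^r$, $C_a=\{x\in F_q^n: H_Cx^T=a\}$. Let $D$ be the linear code of length $q^r$ with coordinate positions indexed by vectors of $F_q^r$, $D=\{y=(y_a)_{a\in F_q^r}: \sum_a y_a=0,\ \sum_a y_a a={\bf 0}\}$. $e_a$ denotes the length-$q^r$ vector with $1$ in position $a$ and $0$ elsewhere, and $D_a=D+e_{\bf 0}-e_a$. A permutation $\tau$ of $F_q^r$ acts on vectors of length $q^r$ by permuting positions, $\tau(e_a)=e_{\tau(a)}$ extended linearly, and $\tau(D)=\{\tau(y):y\in D\}$. $(x|y)$ denotes concatenation, and $X\times Y=\{(x|y):x\in X,y\in Y\}$. -}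

module Defs where

open import Level using (Level; _⊔_)
open import Algebra.Bundles using (CommutativeRing)
open import Data.Nat as ℕ using (ℕ; _^_; _≤_)
open import Data.Nat.Primality using (Prime)
open import Data.Fin using (Fin; _↑ˡ_; _↑ʳ_; _≟_)
open import Data.Fin.Permutation using (Permutation′; _⟨$⟩ˡ_; _⟨$⟩ʳ_)
open import Data.Product using (Σ; ∃; _×_; _,_; proj₁; proj₂)
open import Data.List using (List; []; _∷_)
open import Data.List.Relation.Unary.All using (All)
open import Data.Bool using (if_then_else_)
open import Relation.Nullary using (¬_)
open import Relation.Nullary.Decidable using (⌊_⌋)
open import Relation.Binary.PropositionalEquality using (_≡_)
import Data.Vec.Functional as VF
open import Data.Sum using (_⊎_)
open import Data.Vec.Functional using (_++_)

IsPrimePower : ℕ → Set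
IsPrimePower q = Σ ℕ λ p → Σ ℕ λ k → Prime p × 1 ≤ k × q ≡ p ^ k

module Setup {c ℓ : Level} (R : CommutativeRing c ℓ) where
  open CommutativeRing R

  IsField : Set (c ⊔ ℓ)
  IsField = (¬ (0# ≈ 1#)) × (∀ x → ¬ (x ≈ 0#) → ∃ λ y → x * y ≈ 1#)

  HasSize : ℕ → Set (c ⊔ ℓ)
  HasSize q = Σ (Fin q → Carrier) λ el →
    (∀ x → ∃ λ i → el i ≈ x) × (∀ i j → el i ≈ el j → i ≡ j)

  Vect : ℕ → Set c
  Vect m = Fin m → Carrier

  _≋_ : ∀ {m} → Vect m → Vect m → Set ℓ
  u ≋ w = ∀ i → u i ≈ w i

  0v : ∀ {m} → Vect m
  0v _ = 0#

  _+v_ : ∀ {m} → Vect m → Vect m → Vect m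
  (u +v w) i = u i + w i

  -v_ : ∀ {m} → Vect m → Vect m
  (-v u) i = - (u i)

  _·_ : ∀ {m} → Carrier → Vect m → Vect m
  (λ' · u) i = λ' * u i

  Σ' : ∀ {k} → (Fin k → Carrier) → Carrier
  Σ' = VF.foldr _+_ 0#

  lincomb : ∀ {k m} → (Fin k → Carrier) → (Fin k → Vect m) → Vect m
  lincomb {k} a u i = Σ' (λ j → a j * u j i)

  combo : ∀ {m} → List (Carrier × Vect m) → Vect m
  combo [] = 0v
  combo ((a , u) ∷ L) = (a · u) +v combo L

  Span : ∀ {m p} → (Vect m → Set p) → Vect m → Set (c ⊔ ℓ ⊔ p)
  Span P w = ∃ λ (L : List (Carrier × Vect _)) →
    All (λ t → P (proj₂ t)) L × (w ≋ combo L)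

  LinIndep : ∀ {k m} → (Fin k → Vect m) → Set (c ⊔ ℓ)
  LinIndep u = ∀ a → lincomb a u ≋ 0v → ∀ j → a j ≈ 0#

  IsBasis : ∀ {k m p} → (Vect m → Set p) → (Fin k → Vect m) → Set (c ⊔ ℓ ⊔ p)
  IsBasis P u = (∀ j → P (u j)) × LinIndep u ×
                (∀ w → P w → ∃ λ a → w ≋ lincomb a u)

  mulMV : ∀ {r n} → (Fin r → Fin n → Carrier) → Vect n → Vect r
  mulMV H x i = Σ' (λ j → H i j * x j)

  col : ∀ {r n} → (Fin r → Fin n → Carrier) → Fin n → Vect r
  col H j i = H i j

  -- the columns of H are representatives of the distinct
  -- one-dimensional subspaces of F^r (each exactly once)
  IsHammingCheck : ∀ {r n} → (Fin r → Fin n → Carrier) → Set (c ⊔ ℓ)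
  IsHammingCheck {r} H =
    (∀ j → ¬ (col H j ≋ 0v)) ×
    (∀ (w : Vect r) → ¬ (w ≋ 0v) → ∃ λ j → ∃ λ a → w ≋ (a · col H j)) ×
    (∀ i j a → col H i ≋ (a · col H j) → i ≡ j)

  -- C_a = { x : H x^T = a };  C = C_0
  Cset : ∀ {r n} → (Fin r → Fin n → Carrier) → Vect r → Vect n → Set ℓ
  Cset H a x = mulMV H x ≋ a

  -- enumeration pt of F^r, bijective (up to ≋): position i of a vector
  -- of length N corresponds to the vector pt i ∈ F^r
  IsEnum : ∀ {r N} → (Fin N → Vect r) → Set (c ⊔ ℓ)
  IsEnum {r} pt = (∀ (w : Vect r) → ∃ λ i → pt i ≋ w) ×
                  (∀ i j → pt i ≋ pt j → i ≡ j)

  Dset : ∀ {r N} → (Fin N → Vect r) → Vect N → Set ℓ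
  Dset pt y = (Σ' y ≈ 0#) × ((λ k → Σ' (λ i → y i * pt i k)) ≋ 0v)

  e : ∀ {N} → Fin N → Vect N
  e a b = if ⌊ a ≟ b ⌋ then 1# else 0#

  -- D_a = D + e_0 - e_a   (o is the position of the zero vector)
  Da : ∀ {r N} → (Fin N → Vect r) → Fin N → Fin N → Vect N → Set (c ⊔ ℓ)
  Da pt o a w = ∃ λ y → Dset pt y × (w ≋ ((y +v e o) +v (-v e a)))

  -- action of a permutation on positions: τ(e_a) = e_{τ(a)}
  act : ∀ {N} → Permutation′ N → Vect N → Vect N
  act τ y b = y (τ ⟨$⟩ˡ b)

  τD : ∀ {r N} → (Fin N → Vect r) → Permutation′ N → Vect N → Set (c ⊔ ℓ)
  τD pt τ w = ∃ λ y → Dset pt y × (w ≋ act τ y)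

  left : ∀ {n N} → Vect (n ℕ.+ N) → Vect n
  left {N = N} w i = w (i ↑ˡ N)

  right : ∀ {n N} → Vect (n ℕ.+ N) → Vect N
  right {n = n} w i = w (n ↑ʳ i)

  Sτ : ∀ {r n N} → (Fin r → Fin n → Carrier) → (Fin N → Vect r) → Fin N →
       Permutation′ N → Vect (n ℕ.+ N) → Set (c ⊔ ℓ)
  Sτ H pt o τ w = ∃ λ a → Cset H (pt a) (left w) × Da pt o (τ ⟨$⟩ʳ a) (right w)

  yv : ∀ {N} → Fin N → Fin N → Vect N
  yv o a = e o +v (-v e a)

  BBB : ∀ {n N k l} → Fin N → Permutation′ N → (Fin N → Vect n) →
        (Fin k → Vect n) → (Fin l → Vect N) → Vect (n ℕ.+ N) → Set ℓ
  BBB {N = N} o τ x z v w =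
      (∃ λ a → ¬ (a ≡ o) × (w ≋ (x a ++ yv o (τ ⟨$⟩ʳ a))))
    ⊎ (∃ λ i → w ≋ (z i ++ 0v {N}))
    ⊎ (∃ λ j → w ≋ (0v ++ v j))

  DτD : ∀ {r N} → (Fin N → Vect r) → Permutation′ N → Vect N → Set (c ⊔ ℓ)
  DτD pt τ w = Dset pt w × τD pt τ w

{-# OPTIONS --safe #-}
module Submission where

-- An element of C_a × D_{τ(a)} is (c | d + e_0 − e_{τ(a)}) with c ∈ C_a and d ∈ D, that is
-- (c − x_a | 0) + (x_a | y_{τ(a)}) + (0 | d) with c − x_a ∈ C.  So it suffices that C × 0,
-- every (x_a | y_{τ(a)}) and 0 × D lie in the span.  C × 0 is spanned by B′, and for a = 0
-- we have y_0 = 0 and x_0 ∈ C.  As D is spanned by a basis of D ∩ τ(D) together with the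
-- v_j, it remains to treat d = τ(y) with y ∈ D: then Σ_a y_a (x_a | y_{τ(a)}) = (c′ | −d)
-- with c′ = Σ_a y_a x_a ∈ C, since H c′ = Σ_a y_a a = 0 and Σ_a y_a = 0.

open import Defs
open import Level using (Level)
open import Algebra.Bundles using (CommutativeRing)
open import Data.Nat as ℕ using (ℕ)
open import Data.Fin using (Fin; zero; suc; _↑ʳ_; splitAt; _≟_)
open import Data.Fin.Properties using (splitAt⁻¹-↑ˡ; splitAt⁻¹-↑ʳ)
open import Data.Fin.Permutation using (Permutation′; _⟨$⟩ʳ_; _⟨$⟩ˡ_; inverseˡ; inverseʳ)
open import Data.Product using (_×_; _,_; proj₁; proj₂; map₁)
open import Data.Sum using (inj₁; inj₂)
open import Data.List using (List; []; _∷_)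
import Data.List as List
open import Data.List.Relation.Unary.All using ([]; _∷_)
import Data.List.Relation.Unary.All.Properties as All
import Data.Vec.Functional.Relation.Unary.All.Properties as AllVec
open import Data.Vec.Functional using (_++_)
open import Data.Vec.Functional.Properties using (lookup-++ˡ; lookup-++ʳ)
open import Data.Bool using (if_then_else_)
open import Function.Bundles using (mk⇔)
open import Relation.Nullary using (yes; no)
open import Relation.Nullary.Decidable using (does-⇔; isYes≗does; ⌊⌋-map′)
open import Relation.Binary.PropositionalEquality as ≡ using (_≡_)

module Linear {ℓ₁ ℓ₂} (R : CommutativeRing ℓ₁ ℓ₂) where
  open CommutativeRing R hiding (zero)
  open Setup R
  open import Algebra.Properties.Ring ring using (-1*x≈-x; -‿involutive; x[y-z]≈xy-xz)
  open import Algebra.Properties.Group +-group using (//-rightDividesˡ; //-rightDividesʳ)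
  open import Algebra.Properties.CommutativeSemigroup *-commutativeSemigroup using (x∙yz≈y∙xz)
  open import Algebra.Properties.Semiring.Sum semiring
    using (sum; sum-cong-≋; sum-replicate-zero; ∑-distrib-+; ∑-comm; *-distribˡ-sum; *-distribʳ-sum)
  open import Data.Vec.Functional.Relation.Binary.Equality.Setoid setoid
    using (≋-refl; ≋-sym; ≋-trans; ++⁺)
  open import Relation.Binary.Reasoning.Setoid setoid

  sum-neg : ∀ {k} (f : Fin k → Carrier) → sum (λ i → - f i) ≈ - sum f
  sum-neg f = begin
    sum (λ i → - f i)       ≈⟨ sum-cong-≋ (λ i → -1*x≈-x (f i)) ⟨
    sum (λ i → - 1# * f i)  ≈⟨ *-distribˡ-sum (- 1#) f ⟨
    - 1# * sum f            ≈⟨ -1*x≈-x (sum f) ⟩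
    - sum f                 ∎

  sum-zero : ∀ {k} {f : Fin k → Carrier} → (∀ i → f i ≈ 0#) → sum f ≈ 0#
  sum-zero {k} f≈0 = trans (sum-cong-≋ f≈0) (sum-replicate-zero k)

  ++-cong : ∀ {n N} {u u′ : Vect n} {w w′ : Vect N} → u ≋ u′ → w ≋ w′ → (u ++ w) ≋ (u′ ++ w′)
  ++-cong = ++⁺ _≈_

  left-++ : ∀ {n N} (u : Vect n) (w : Vect N) → left (u ++ w) ≋ u
  left-++ u w i = reflexive (lookup-++ˡ u w i)

  right-++ : ∀ {n N} (u : Vect n) (w : Vect N) → right (u ++ w) ≋ w
  right-++ u w i = reflexive (lookup-++ʳ u w i)

  ≋-left++right : ∀ {n N} (w : Vect (n ℕ.+ N)) → w ≋ (left {n} {N} w ++ right w)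
  ≋-left++right {n} w i with splitAt n i in eq
  ... | inj₁ j = reflexive (≡.cong w (≡.sym (splitAt⁻¹-↑ˡ eq)))
  ... | inj₂ j = reflexive (≡.cong w (≡.sym (splitAt⁻¹-↑ʳ eq)))

  +v-++ : ∀ {n N} (u u′ : Vect n) (w w′ : Vect N) →
          ((u ++ w) +v (u′ ++ w′)) ≋ ((u +v u′) ++ (w +v w′))
  +v-++ {n} u u′ w w′ i with splitAt n i
  ... | inj₁ j = refl
  ... | inj₂ j = refl

  -v-++ : ∀ {n N} (u : Vect n) (w : Vect N) → (-v (u ++ w)) ≋ ((-v u) ++ (-v w))
  -v-++ {n} u w i with splitAt n i
  ... | inj₁ j = refl
  ... | inj₂ j = refl

  lincomb-++ : ∀ {k n N} (α : Fin k → Carrier) (f : Fin k → Vect n) (g : Fin k → Vect N) →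
               lincomb α (λ j → f j ++ g j) ≋ (lincomb α f ++ lincomb α g)
  lincomb-++ {n = n} α f g i with splitAt n i
  ... | inj₁ j = refl
  ... | inj₂ j = refl

  lincomb-0v : ∀ {k m} (α : Fin k → Carrier) → lincomb {m = m} α (λ _ → 0v) ≋ 0v
  lincomb-0v α i = sum-zero (λ j → zeroʳ (α j))

  module _ {m p} (Q : Vect m → Set p) where

    Span-resp : ∀ {u w} → u ≋ w → Span Q u → Span Q w
    Span-resp u≋w (L , L⊆Q , u≋L) = L , L⊆Q , ≋-trans (≋-sym u≋w) u≋L

    Span-gen : ∀ {w} → Q w → Span Q w
    Span-gen {w} w∈Q =
      (1# , w) ∷ [] , w∈Q ∷ [] , λ i → sym (trans (+-identityʳ _) (*-identityˡ (w i)))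

    combo-++ : ∀ (L L′ : List (Carrier × Vect m)) → combo (L List.++ L′) ≋ (combo L +v combo L′)
    combo-++ [] L′ i = sym (+-identityˡ _)
    combo-++ ((a , u) ∷ L) L′ i = trans (+-congˡ (combo-++ L L′ i)) (sym (+-assoc _ _ _))

    combo-scale : ∀ a (L : List (Carrier × Vect m)) →
                  combo (List.map (map₁ (a *_)) L) ≋ (a · combo L)
    combo-scale a [] i = sym (zeroʳ a)
    combo-scale a ((b , u) ∷ L) i =
      trans (+-cong (*-assoc a b (u i)) (combo-scale a L i)) (sym (distribˡ a _ _))

    Span-+v : ∀ {u w} → Span Q u → Span Q w → Span Q (u +v w)
    Span-+v (L , L⊆Q , u≋L) (L′ , L′⊆Q , w≋L′) =
      L List.++ L′ , All.++⁺ L⊆Q L′⊆Q ,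
      λ i → trans (+-cong (u≋L i) (w≋L′ i)) (sym (combo-++ L L′ i))

    Span-· : ∀ a {w} → Span Q w → Span Q (a · w)
    Span-· a (L , L⊆Q , w≋L) =
      List.map (map₁ (a *_)) L , All.map⁺ L⊆Q ,
      λ i → trans (*-congˡ (w≋L i)) (sym (combo-scale a L i))

    Span-neg : ∀ {w} → Span Q w → Span Q (-v w)
    Span-neg {w} w∈Span = Span-resp (λ i → -1*x≈-x (w i)) (Span-· (- 1#) w∈Span)

    Span-lincomb : ∀ {k} (α : Fin k → Carrier) (g : Fin k → Vect m) → (∀ j → Span Q (g j)) →
                   Span Q (lincomb α g)
    Span-lincomb {ℕ.zero} α g g⊆Span = [] , [] , λ i → refl
    Span-lincomb {ℕ.suc k} α g g⊆Span =
      Span-+v (Span-· (α zero) (g⊆Span zero))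
              (Span-lincomb (λ j → α (suc j)) (λ j → g (suc j)) (λ j → g⊆Span (suc j)))

  module _ {r n} (H : Fin r → Fin n → Carrier) where

    mulMV-cong : ∀ {u w : Vect n} → u ≋ w → mulMV H u ≋ mulMV H w
    mulMV-cong u≋w i = sum-cong-≋ (λ j → *-congˡ (u≋w j))

    mulMV-0v : mulMV H 0v ≋ 0v
    mulMV-0v i = sum-zero (λ j → zeroʳ (H i j))

    mulMV-sub : ∀ (u w : Vect n) → mulMV H (u +v (-v w)) ≋ (mulMV H u +v (-v mulMV H w))
    mulMV-sub u w i = begin
      sum (λ j → H i j * (u j + - w j))
        ≈⟨ sum-cong-≋ (λ j → x[y-z]≈xy-xz (H i j) (u j) (w j)) ⟩
      sum (λ j → H i j * u j + - (H i j * w j))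
        ≈⟨ ∑-distrib-+ (λ j → H i j * u j) (λ j → - (H i j * w j)) ⟩
      mulMV H u i + sum (λ j → - (H i j * w j))
        ≈⟨ +-congˡ (sum-neg (λ j → H i j * w j)) ⟩
      mulMV H u i + - mulMV H w i ∎

    mulMV-lincomb : ∀ {k} (α : Fin k → Carrier) (x : Fin k → Vect n) →
                    mulMV H (lincomb α x) ≋ lincomb α (λ a → mulMV H (x a))
    mulMV-lincomb α x i = begin
      sum (λ j → H i j * sum (λ a → α a * x a j))
        ≈⟨ sum-cong-≋ (λ j → *-distribˡ-sum (H i j) (λ a → α a * x a j)) ⟩
      sum (λ j → sum (λ a → H i j * (α a * x a j)))
        ≈⟨ ∑-comm (λ j a → H i j * (α a * x a j)) ⟩
      sum (λ a → sum (λ j → H i j * (α a * x a j)))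
        ≈⟨ sum-cong-≋ (λ a → sum-cong-≋ (λ j → x∙yz≈y∙xz (H i j) (α a) (x a j))) ⟩
      sum (λ a → sum (λ j → α a * (H i j * x a j)))
        ≈⟨ sum-cong-≋ (λ a → *-distribˡ-sum (α a) (λ j → H i j * x a j)) ⟨
      sum (λ a → α a * sum (λ j → H i j * x a j)) ∎

    Cset-resp : ∀ {a u w} → u ≋ w → Cset H a u → Cset H a w
    Cset-resp u≋w u∈C i = trans (mulMV-cong (≋-sym u≋w) i) (u∈C i)

    Cset-sub : ∀ {a u w} → Cset H a u → Cset H a w → Cset H 0v (u +v (-v w))
    Cset-sub {u = u} {w} u∈C w∈C i =
      trans (mulMV-sub u w i) (trans (+-cong (u∈C i) (-‿cong (w∈C i))) (-‿inverseʳ _))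

  e-⟨$⟩ʳ : ∀ {N} (τ : Permutation′ N) a b → e (τ ⟨$⟩ʳ a) b ≡ e a (τ ⟨$⟩ˡ b)
  e-⟨$⟩ʳ τ a b = ≡.cong (λ t → if t then 1# else 0#)
    (≡.trans (isYes≗does (τ ⟨$⟩ʳ a ≟ b))
    (≡.trans (does-⇔ (mk⇔ to from) (τ ⟨$⟩ʳ a ≟ b) (a ≟ τ ⟨$⟩ˡ b))
             (≡.sym (isYes≗does (a ≟ τ ⟨$⟩ˡ b)))))
    where
    to : τ ⟨$⟩ʳ a ≡ b → a ≡ τ ⟨$⟩ˡ b
    to eq = ≡.trans (≡.sym (inverseˡ τ)) (≡.cong (τ ⟨$⟩ˡ_) eq)
    from : a ≡ τ ⟨$⟩ˡ b → τ ⟨$⟩ʳ a ≡ b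
    from eq = ≡.trans (≡.cong (τ ⟨$⟩ʳ_) eq) (inverseʳ τ)

  e-suc : ∀ {N} (a b : Fin N) → e (suc a) (suc b) ≡ e a b
  e-suc a b = ≡.cong (λ t → if t then 1# else 0#) (⌊⌋-map′ _ _ (a ≟ b))

  lincomb-e : ∀ {N} (f : Vect N) → lincomb f e ≋ f
  lincomb-e {ℕ.suc N} f zero =
    trans (+-cong (*-identityʳ _) (sum-zero {N} (λ a → zeroʳ _))) (+-identityʳ _)
  lincomb-e {ℕ.suc N} f (suc b) = begin
    f zero * 0# + sum (λ a → f (suc a) * e (suc a) (suc b))
      ≈⟨ +-cong (zeroʳ _) (sum-cong-≋ (λ a → *-congˡ (reflexive (e-suc a b)))) ⟩
    0# + lincomb (λ a → f (suc a)) e b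
      ≈⟨ +-identityˡ _ ⟩
    lincomb (λ a → f (suc a)) e b
      ≈⟨ lincomb-e (λ a → f (suc a)) b ⟩
    f (suc b) ∎

  lincomb-e∘⟨$⟩ʳ : ∀ {N} (τ : Permutation′ N) (y : Vect N) →
                   lincomb y (λ a → e (τ ⟨$⟩ʳ a)) ≋ act τ y
  lincomb-e∘⟨$⟩ʳ τ y b =
    trans (sum-cong-≋ (λ a → *-congˡ (reflexive (e-⟨$⟩ʳ τ a b)))) (lincomb-e y (τ ⟨$⟩ˡ b))

  lincomb-yv : ∀ {N} (o : Fin N) (τ : Permutation′ N) (y : Vect N) → sum y ≈ 0# →
               lincomb y (λ a → yv o (τ ⟨$⟩ʳ a)) ≋ (-v act τ y)
  lincomb-yv o τ y Σy≈0 b = begin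
    sum (λ a → y a * (e o b + - e (τ ⟨$⟩ʳ a) b))
      ≈⟨ sum-cong-≋ (λ a → x[y-z]≈xy-xz (y a) (e o b) (e (τ ⟨$⟩ʳ a) b)) ⟩
    sum (λ a → y a * e o b + - (y a * e (τ ⟨$⟩ʳ a) b))
      ≈⟨ ∑-distrib-+ (λ a → y a * e o b) (λ a → - (y a * e (τ ⟨$⟩ʳ a) b)) ⟩
    sum (λ a → y a * e o b) + sum (λ a → - (y a * e (τ ⟨$⟩ʳ a) b))
      ≈⟨ +-cong (sym (*-distribʳ-sum (e o b) y)) (sum-neg (λ a → y a * e (τ ⟨$⟩ʳ a) b)) ⟩
    sum y * e o b + - lincomb y (λ a → e (τ ⟨$⟩ʳ a)) b
      ≈⟨ +-cong (trans (*-congʳ Σy≈0) (zeroˡ _)) (-‿cong (lincomb-e∘⟨$⟩ʳ τ y b)) ⟩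
    0# + - act τ y b
      ≈⟨ +-identityˡ _ ⟩
    - act τ y b ∎

  Dset-0v : ∀ {r N} (pt : Fin N → Vect r) → Dset pt 0v
  Dset-0v {N = N} pt = sum-zero {N} (λ _ → refl) , λ k → sum-zero (λ i → zeroˡ (pt i k))

  module _ {r N} (pt : Fin N → Vect r) (o : Fin N) where

    Dset⊆Da-o : ∀ {d} → Dset pt d → Da pt o o d
    Dset⊆Da-o {d} d∈D = d , d∈D , λ i → sym (//-rightDividesʳ (e o i) (d i))

    yv∈Da : ∀ a → Da pt o a (yv o a)
    yv∈Da a = 0v , Dset-0v pt , λ i → +-congʳ (sym (+-identityˡ (e o i)))

    Da-resp : ∀ {a u w} → u ≋ w → Da pt o a u → Da pt o a w
    Da-resp u≋w (y , y∈D , u≋) = y , y∈D , ≋-trans (≋-sym u≋w) u≋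

    Sτ-intro : ∀ {n} (H : Fin r → Fin n → Carrier) (τ : Permutation′ N) a {u d w} →
               Cset H (pt a) u → Da pt o (τ ⟨$⟩ʳ a) d → w ≋ (u ++ d) → Sτ H pt o τ w
    Sτ-intro H τ a {u} {d} u∈C d∈D w≋ =
      a , Cset-resp H (λ i → sym (trans (w≋ _) (left-++ u d i))) u∈C
        , Da-resp (λ i → sym (trans (w≋ _) (right-++ u d i))) d∈D

  module Spanning {r n N : ℕ} (H : Fin r → Fin n → Carrier) (pt : Fin N → Vect r)
    (o : Fin N) (pt-o : pt o ≋ 0v) (τ : Permutation′ N) (τ-o : τ ⟨$⟩ʳ o ≡ o)
    (x : Fin N → Vect n) (x∈C : ∀ a → Cset H (pt a) (x a))
    {k : ℕ} (z : Fin k → Vect n) (z-basis : IsBasis (Cset H 0v) z)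
    {m l : ℕ} (u : Fin m → Vect N) (v : Fin l → Vect N)
    (u-basis : IsBasis (DτD pt τ) u) (uv-basis : IsBasis (Dset pt) (u ++ v)) where

    B : Vect (n ℕ.+ N) → Set ℓ₂
    B = BBB o τ x z v

    C⊆C-pt-o : ∀ {c} → Cset H 0v c → Cset H (pt o) c
    C⊆C-pt-o c∈C i = trans (c∈C i) (sym (pt-o i))

    D⊆D-τo : ∀ {d} → Dset pt d → Da pt o (τ ⟨$⟩ʳ o) d
    D⊆D-τo d∈D rewrite τ-o = Dset⊆Da-o pt o d∈D

    v∈D : ∀ j → Dset pt (v j)
    v∈D j = ≡.subst (Dset pt) (lookup-++ʳ u v j) (proj₁ uv-basis (m ↑ʳ j))

    B⊆Sτ : ∀ w → B w → Sτ H pt o τ w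
    B⊆Sτ w (inj₁ (a , _ , w≋)) = Sτ-intro pt o H τ a (x∈C a) (yv∈Da pt o _) w≋
    B⊆Sτ w (inj₂ (inj₁ (i , w≋))) =
      Sτ-intro pt o H τ o (C⊆C-pt-o (proj₁ z-basis i)) (D⊆D-τo (Dset-0v pt)) w≋
    B⊆Sτ w (inj₂ (inj₂ (j , w≋))) =
      Sτ-intro pt o H τ o (C⊆C-pt-o (mulMV-0v H)) (D⊆D-τo (v∈D j)) w≋

    C×0⊆Span : ∀ {c} → Cset H 0v c → Span B (c ++ 0v)
    C×0⊆Span {c} c∈C with proj₂ (proj₂ z-basis) c c∈C
    ... | α , c≋ =
      Span-resp B (≋-trans (lincomb-++ α z (λ _ → 0v)) (++-cong (≋-sym c≋) (lincomb-0v α)))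
        (Span-lincomb B α (λ i → z i ++ 0v) (λ i → Span-gen B (inj₂ (inj₁ (i , ≋-refl)))))

    x++y∈Span : ∀ a → Span B (x a ++ yv o (τ ⟨$⟩ʳ a))
    x++y∈Span a with a ≟ o
    ... | no a≢o = Span-gen B (inj₁ (a , a≢o , ≋-refl))
    ... | yes ≡.refl rewrite τ-o =
      Span-resp B (++-cong ≋-refl (λ i → sym (-‿inverseʳ (e o i))))
                  (C×0⊆Span (λ i → trans (x∈C o i) (pt-o i)))

    0×τD⊆Span : ∀ {d} → τD pt τ d → Span B (0v ++ d)
    0×τD⊆Span {d} (y , y∈D , d≋τy) =
      Span-resp B split (Span-+v B (C×0⊆Span c∈C) (Span-neg B (Span-lincomb B y g x++y∈Span)))
      where
      g : Fin N → Vect (n ℕ.+ N)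
      g a = x a ++ yv o (τ ⟨$⟩ʳ a)
      c : Vect n
      c = lincomb y x
      c∈C : Cset H 0v c
      c∈C i = trans (mulMV-lincomb H y x i)
                    (trans (sum-cong-≋ (λ a → *-congˡ (x∈C a i))) (proj₂ y∈D i))
      lincomb-g : lincomb y g ≋ (c ++ (-v d))
      lincomb-g = ≋-trans (lincomb-++ y x _)
        (++-cong ≋-refl (≋-trans (lincomb-yv o τ y (proj₁ y∈D)) (λ b → -‿cong (sym (d≋τy b)))))
      split : ((c ++ 0v) +v (-v lincomb y g)) ≋ (0v ++ d)
      split = ≋-trans (λ i → +-congˡ (-‿cong (lincomb-g i)))
        (≋-trans (λ i → +-congˡ (-v-++ c (-v d) i))
        (≋-trans (+v-++ c (-v c) 0v (-v (-v d)))
                 (++-cong (λ i → -‿inverseʳ (c i))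
                          (λ i → trans (+-identityˡ _) (-‿involutive (d i))))))

    0×D⊆Span : ∀ {d} → Dset pt d → Span B (0v ++ d)
    0×D⊆Span {d} d∈D with proj₂ (proj₂ uv-basis) d d∈D
    ... | β , d≋ =
      Span-resp B (≋-trans (lincomb-++ β (λ _ → 0v) (u ++ v)) (++-cong (lincomb-0v β) (≋-sym d≋)))
        (Span-lincomb B β (λ j → 0v ++ (u ++ v) j)
          (AllVec.++⁺ (λ t → Span B (0v ++ t)) {xs = u} {ys = v} u∈Span v∈Span))
      where
      u∈Span : ∀ i → Span B (0v ++ u i)
      u∈Span i = 0×τD⊆Span (proj₂ (proj₁ u-basis i))
      v∈Span : ∀ j → Span B (0v ++ v j)
      v∈Span j = Span-gen B (inj₂ (inj₂ (j , ≋-refl)))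

    Sτ⊆Span : ∀ w → Sτ H pt o τ w → Span B w
    Sτ⊆Span w (a , left∈C , (d , d∈D , right≋)) =
      Span-resp B w≋ (Span-+v B (Span-+v B (C×0⊆Span c∈C) (x++y∈Span a)) (0×D⊆Span d∈D))
      where
      c : Vect n
      c = left w +v (-v x a)
      c∈C : Cset H 0v c
      c∈C = Cset-sub H left∈C (x∈C a)
      left≋ : ((c +v x a) +v 0v) ≋ left w
      left≋ i = trans (+-identityʳ _) (//-rightDividesˡ (x a i) (left w i))
      right≋′ : ((0v +v yv o (τ ⟨$⟩ʳ a)) +v d) ≋ right w
      right≋′ i = trans (+-congʳ (+-identityˡ _))
                        (trans (+-comm _ _) (trans (sym (+-assoc _ _ _)) (sym (right≋ i))))
      w≋ : (((c ++ 0v) +v (x a ++ yv o (τ ⟨$⟩ʳ a))) +v (0v ++ d)) ≋ w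
      w≋ = ≋-trans (λ i → +-congʳ (+v-++ c (x a) 0v (yv o (τ ⟨$⟩ʳ a)) i))
        (≋-trans (+v-++ (c +v x a) 0v (0v +v yv o (τ ⟨$⟩ʳ a)) d)
        (≋-trans (++-cong left≋ right≋′) (≋-sym (≋-left++right {n} {N} w))))

open import Data.Nat using (_^_; _≤_; _∸_; _*_; _+_)

lemma2 : ∀ {c ℓ : Level} (R : CommutativeRing c ℓ) →
    let open Setup R in
    (q r n : ℕ) →
    IsField → HasSize q → IsPrimePower q → 1 ≤ r →
    n * (q ∸ 1) ≡ q ^ r ∸ 1 →
    (H : Fin r → Fin n → CommutativeRing.Carrier R) → IsHammingCheck H →
    (pt : Fin (q ^ r) → Vect r) → IsEnum pt →
    (o : Fin (q ^ r)) → pt o ≋ 0v →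
    (τ : Permutation′ (q ^ r)) → τ ⟨$⟩ʳ o ≡ o →
    (x : Fin (q ^ r) → Vect n) → (∀ a → Cset H (pt a) (x a)) →
    (k : ℕ) (z : Fin k → Vect n) → IsBasis (Cset H 0v) z →
    (m l : ℕ) (u : Fin m → Vect (q ^ r)) (v : Fin l → Vect (q ^ r)) →
    IsBasis (DτD pt τ) u →
    IsBasis (Dset pt) (u ++ v) →
    (∀ w → BBB o τ x z v w → Sτ H pt o τ w)
    × (∀ w → Sτ H pt o τ w → Span (BBB o τ x z v) w)
lemma2 R q r n _ _ _ _ _ H _ pt _ o pt-o τ τ-o x x∈C k z z-basis m l u v u-basis uv-basis =
  B⊆Sτ , Sτ⊆Span
  where open Linear.Spanning R H pt o pt-o τ τ-o x x∈C z z-basis u v u-basis uv-basis
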